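{- Let $G$ be a connected graph. Then every total mutual-visibility set of $G$ is independent if and only if for every edge $uv\in E(G)$ at least one of the following holds: (a) $u$ or $v$ is the middle vertex of a convex $P_3$; (b) $uv$ is the middle edge of a convex diamond.
   Context: All graphs are finite and simple. For $X\subseteq V(G)$, two vertices $u,v$ are $X$-visible if there is a shortest $u,v$-path $P$ with $V(P)\cap X\subseteq\{u,v\}$; $X$ is a total mutual-visibility set if any two vertices of $V(G)$ are $X$-visible. A convex $P_3$ is a path $xyz$ with $xz\notin E(G)$ and $N(x)\cap N(z)=\{y\}$; $y$ is its middle vertex. A diamond is $K_4$ minus an edge. A convex diamond $v_1v_2v_3v_4$ is a diamond subgraph in which $v_1,v_3$ are nonadjacent and $N(v_1)\cap N(v_3)=\{v_2,v_4\}$; the edge $v_2v_4$ is its middle edge. -}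

module Defs where

open import Data.Nat using (ℕ; zero; suc; _≤_)
open import Data.Fin using (Fin)
open import Data.Fin.Subset using (Subset; _∈_)
open import Data.Product using (Σ; ∃; ∃-syntax; _×_; _,_)
open import Data.Sum using (_⊎_)
open import Relation.Nullary using (¬_; Dec)
open import Relation.Binary.PropositionalEquality using (_≡_; _≢_)

record Graph : Set₁ where
  field
    n     : ℕ
    E     : Fin n → Fin n → Set
    E-dec : ∀ u v → Dec (E u v)
    sym   : ∀ {u v} → E u v → E v u
    irr   : ∀ {u} → ¬ E u u

module _ (G : Graph) where
  open Graph G

  V : Set
  V = Fin n

  data Walk : V → V → ℕ → Set where
    []  : ∀ {u} → Walk u u 0
    _∷_ : ∀ {u w v k} → E u w → Walk w v k → Walk u v (suc k)

  data OnWalk (x : V) : ∀ {u v k} → Walk u v k → Set where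
    here-end : OnWalk x {x} {x} []
    here     : ∀ {w v k} (e : E x w) (p : Walk w v k) → OnWalk x (e ∷ p)
    there    : ∀ {u w v k} (e : E u w) {p : Walk w v k} → OnWalk x p → OnWalk x (e ∷ p)

  IsShortest : ∀ {u v k} → Walk u v k → Set
  IsShortest {u} {v} {k} _ = ∀ {k'} → Walk u v k' → k ≤ k'

  Connected : Set
  Connected = ∀ (u v : V) → ∃[ k ] Walk u v k

  Visible : Subset n → V → V → Set
  Visible X u v =
    ∃[ k ] Σ (Walk u v k) λ P →
      IsShortest P × (∀ x → OnWalk x P → x ∈ X → x ≡ u ⊎ x ≡ v)

  IsTotalMutualVisibility : Subset n → Set
  IsTotalMutualVisibility X = ∀ (u v : V) → Visible X u v

  Independent : Subset n → Set
  Independent X = ∀ (u v : V) → u ∈ X → v ∈ X → ¬ E u v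

  IsConvexP3 : V → V → V → Set
  IsConvexP3 x y z =
    E x y × E y z × x ≢ z × ¬ E x z × (∀ w → E x w → E z w → w ≡ y)

  IsMiddleOfConvexP3 : V → Set
  IsMiddleOfConvexP3 y = ∃[ x ] ∃[ z ] IsConvexP3 x y z

  IsConvexDiamond : V → V → V → V → Set
  IsConvexDiamond v1 v2 v3 v4 =
    E v1 v2 × E v2 v3 × E v3 v4 × E v4 v1 × E v2 v4 × v1 ≢ v3 × ¬ E v1 v3 ×
    (∀ w → E v1 w → E v3 w → w ≡ v2 ⊎ w ≡ v4)

  IsMiddleEdgeOfConvexDiamond : V → V → Set
  IsMiddleEdgeOfConvexDiamond u v =
    ∃[ v1 ] ∃[ v2 ] ∃[ v3 ] ∃[ v4 ]
      IsConvexDiamond v1 v2 v3 v4 × ((v2 ≡ u × v4 ≡ v) ⊎ (v2 ≡ v × v4 ≡ u))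

{-# OPTIONS --safe #-}
-- A set X is total mutual-visibility as soon as every two vertices at distance two have a
-- common neighbour outside X: such a neighbour lets one reroute any geodesic, two steps at a
-- time, so that its interior avoids X. Conversely, two vertices at distance two all of whose
-- common neighbours lie in X are not X-visible. A convex P₃ with middle vertex in X, or a
-- convex diamond with middle edge in X, yields such a pair; and if an edge uv admits neither,
-- every pair at distance two has a common neighbour outside {u, v}, so {u, v} is a total
-- mutual-visibility set that is not independent.
module Submission where

open import Defs
open import Data.Empty using (⊥-elim)
open import Data.Fin using (Fin; _≟_)
open import Data.Fin.Properties using (any?; all?)
open import Data.Fin.Subset using (Subset; _∈_; _∉_; ⁅_⁆; _∪_)
open import Data.Fin.Subset.Properties using (_∈?_; x∈⁅x⁆; x∈⁅y⁆⇒x≡y; x∈p∪q⁻; x∈p∪q⁺)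
open import Data.Nat using (suc; _<_; s≤s)
open import Data.Nat.Induction using (<-wellFounded)
open import Data.Nat.Properties using (anyUpTo?; ≮⇒≥; ≤-pred; n≮n; m+n≮n)
open import Data.Product using (_×_; _,_; Σ; ∃-syntax; proj₂)
open import Data.Sum using (_⊎_; inj₁; inj₂; [_,_]; swap)
open import Function.Bundles using (_⇔_; mk⇔)
open import Induction.WellFounded using (Acc; acc)
open import Relation.Nullary using (¬_; Dec; yes; no)
open import Relation.Nullary.Decidable using (_×-dec_; _⊎-dec_; _→-dec_; ¬?; decidable-stable)
open import Relation.Binary.PropositionalEquality using (_≡_; _≢_; refl; sym; subst)

∈-pair : ∀ {n} {u v w : Fin n} → w ∈ ⁅ u ⁆ ∪ ⁅ v ⁆ → w ≡ u ⊎ w ≡ v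
∈-pair {u = u} {v = v} w∈ with x∈p∪q⁻ ⁅ u ⁆ ⁅ v ⁆ w∈
... | inj₁ w∈u = inj₁ (x∈⁅y⁆⇒x≡y u w∈u)
... | inj₂ w∈v = inj₂ (x∈⁅y⁆⇒x≡y v w∈v)

∈-either : ∀ {n} {X : Subset n} {u v w} → u ∈ X → v ∈ X → w ≡ u ⊎ w ≡ v → w ∈ X
∈-either u∈X _ (inj₁ refl) = u∈X
∈-either _ v∈X (inj₂ refl) = v∈X

module _ (G : Graph) where
  open Graph G renaming (sym to E-sym)

  walk? : ∀ k x y → Dec (Walk G x y k)
  walk? 0 x y with x ≟ y
  ... | yes refl = yes []
  ... | no x≢y   = no λ { [] → x≢y refl }
  walk? (suc k) x y with any? (λ w → E-dec x w ×-dec walk? k w y)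
  ... | yes (_ , e , P) = yes (e ∷ P)
  ... | no ¬step        = no λ { (e ∷ P) → ¬step (_ , e , P) }

  shortest-walk : ∀ {x y k} → Walk G x y k → ∃[ j ] Σ (Walk G x y j) (IsShortest G)
  shortest-walk {x} {y} {k} = go (<-wellFounded k)
    where
    go : ∀ {k} → Acc _<_ k → Walk G x y k → ∃[ j ] Σ (Walk G x y j) (IsShortest G)
    go {k} (acc shorter) P with anyUpTo? (λ j → walk? j x y) k
    ... | yes (j , j<k , Q) = go (shorter j<k) Q
    ... | no ¬Q = k , P , λ {k'} Q → ≮⇒≥ (λ k'<k → ¬Q (k' , k'<k , Q))

  ∷-shortest⇒shortest : ∀ {x w y k} (e : E x w) (P : Walk G w y k) →
                        IsShortest G (e ∷ P) → IsShortest G P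
  ∷-shortest⇒shortest e _ sh Q = ≤-pred (sh (e ∷ Q))

  InteriorAvoids : Subset n → ∀ {x y k} → Walk G x y k → Set
  InteriorAvoids X {x} {y} P = ∀ z → OnWalk G z P → z ∈ X → z ≡ x ⊎ z ≡ y

  AtDistanceTwo : V G → V G → Set
  AtDistanceTwo p q = p ≢ q × ¬ E p q × ∃[ a ] (E p a × E a q)

  shortest⇒distance-two : ∀ {x a b y k} (e₁ : E x a) (e₂ : E a b) (P : Walk G b y k) →
                          IsShortest G (e₁ ∷ (e₂ ∷ P)) → AtDistanceTwo x b
  shortest⇒distance-two e₁ e₂ P sh =
    (λ { refl → m+n≮n 1 _ (sh P) }) , (λ xb → n≮n _ (sh (xb ∷ P))) , _ , e₁ , e₂

  CommonNeighbourOutside : Subset n → Set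
  CommonNeighbourOutside X = ∀ {p q} → AtDistanceTwo p q → ∃[ w ] (E p w × E w q × w ∉ X)

  ∷-interior-avoids : ∀ {X x w y k} (e : E x w) → w ∉ X → (Q : Walk G w y k) →
                      InteriorAvoids X Q → InteriorAvoids X (e ∷ Q)
  ∷-interior-avoids _ _ _ _ _ (here _ _) _ = inj₁ refl
  ∷-interior-avoids _ w∉X _ avoids z (there _ z∈Q) z∈X with avoids z z∈Q z∈X
  ... | inj₁ refl = ⊥-elim (w∉X z∈X)
  ... | inj₂ z≡y  = inj₂ z≡y

  reroute : ∀ {X} → CommonNeighbourOutside X → ∀ {k x y} (P : Walk G x y k) → IsShortest G P →
            Σ (Walk G x y k) (InteriorAvoids X)
  reroute _ [] _ = [] , λ { _ here-end _ → inj₁ refl }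
  reroute _ (e ∷ []) _ =
    e ∷ [] , λ { _ (here _ _) _ → inj₁ refl ; _ (there _ here-end) _ → inj₂ refl }
  reroute {X} outside {suc (suc k)} {x} {y} (e₁ ∷ (e₂ ∷ P)) sh =
    bypass (outside (shortest⇒distance-two e₁ e₂ P sh)) (λ wb → reroute outside (wb ∷ P))
    where
    -- The recursive call is made in the clause itself, not inside bypass: only there does
    -- the termination checker accept it.
    bypass : ∃[ w ] (E x w × E w _ × w ∉ X) →
             (∀ {w} (wb : E w _) → IsShortest G (wb ∷ P) →
                Σ (Walk G w y (suc k)) (InteriorAvoids X)) →
             Σ (Walk G x y (suc (suc k))) (InteriorAvoids X)
    bypass (w , xw , wb , w∉X) reroute-tail
      with reroute-tail wb (∷-shortest⇒shortest xw (wb ∷ P) sh)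
    ... | Q , avoids = xw ∷ Q , ∷-interior-avoids xw w∉X Q avoids

  common-neighbour-outside⇒total-mutual-visibility :
    ∀ {X} → Connected G → CommonNeighbourOutside X → IsTotalMutualVisibility G X
  common-neighbour-outside⇒total-mutual-visibility connected outside x y
    with shortest-walk (proj₂ (connected x y))
  ... | k , P , sh with reroute outside P sh
  -- IsShortest only looks at the endpoints and the length, so sh also certifies Q.
  ...   | Q , avoids = k , Q , sh , avoids

  common-neighbours-in⇒¬visible : ∀ {X p q} → AtDistanceTwo p q →
                                  (∀ w → E p w → E q w → w ∈ X) → ¬ Visible G X p q
  common-neighbours-in⇒¬visible (p≢q , _) _ (_ , [] , _) = p≢q refl
  common-neighbours-in⇒¬visible (_ , ¬pq , _) _ (_ , e ∷ [] , _) = ¬pq e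
  common-neighbours-in⇒¬visible _ all∈X (_ , _∷_ {w = m} pm (mq ∷ []) , _ , avoids)
    with avoids m (there pm (here mq [])) (all∈X m pm (E-sym mq))
  ... | inj₁ refl = irr pm
  ... | inj₂ refl = irr mq
  common-neighbours-in⇒¬visible (_ , _ , _ , pa , aq) _ (_ , _ ∷ (_ ∷ (_ ∷ _)) , sh , _)
    with sh (pa ∷ (aq ∷ []))
  ... | s≤s (s≤s ())

  middle-of-convex-P3⇒¬total-mutual-visibility :
    ∀ {X y} → y ∈ X → IsMiddleOfConvexP3 G y → ¬ IsTotalMutualVisibility G X
  middle-of-convex-P3⇒¬total-mutual-visibility {X} y∈X (x , z , xy , yz , x≢z , ¬xz , only-y) tmv =
    common-neighbours-in⇒¬visible (x≢z , ¬xz , _ , xy , yz)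
      (λ w xw zw → subst (_∈ X) (sym (only-y w xw zw)) y∈X) (tmv x z)

  convex-diamond⇒¬total-mutual-visibility :
    ∀ {X v₁ v₂ v₃ v₄} → v₂ ∈ X → v₄ ∈ X → IsConvexDiamond G v₁ v₂ v₃ v₄ →
    ¬ IsTotalMutualVisibility G X
  convex-diamond⇒¬total-mutual-visibility {v₁ = v₁} {v₃ = v₃} v₂∈X v₄∈X
    (e₁₂ , e₂₃ , _ , _ , _ , v₁≢v₃ , ¬e₁₃ , only-v₂v₄) tmv =
    common-neighbours-in⇒¬visible (v₁≢v₃ , ¬e₁₃ , _ , e₁₂ , e₂₃)
      (λ w e₁w e₃w → ∈-either v₂∈X v₄∈X (only-v₂v₄ w e₁w e₃w)) (tmv v₁ v₃)

  middle-edge-of-convex-diamond⇒¬total-mutual-visibility :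
    ∀ {X u v} → u ∈ X → v ∈ X → IsMiddleEdgeOfConvexDiamond G u v → ¬ IsTotalMutualVisibility G X
  middle-edge-of-convex-diamond⇒¬total-mutual-visibility u∈X v∈X
    (_ , _ , _ , _ , diamond , inj₁ (refl , refl)) =
    convex-diamond⇒¬total-mutual-visibility u∈X v∈X diamond
  middle-edge-of-convex-diamond⇒¬total-mutual-visibility u∈X v∈X
    (_ , _ , _ , _ , diamond , inj₂ (refl , refl)) =
    convex-diamond⇒¬total-mutual-visibility v∈X u∈X diamond

  ConvexObstruction : V G → V G → Set
  ConvexObstruction u v =
    (IsMiddleOfConvexP3 G u ⊎ IsMiddleOfConvexP3 G v) ⊎ IsMiddleEdgeOfConvexDiamond G u v

  convex-obstruction⇒¬total-mutual-visibility :
    ∀ {X u v} → u ∈ X → v ∈ X → ConvexObstruction u v → ¬ IsTotalMutualVisibility G X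
  convex-obstruction⇒¬total-mutual-visibility u∈X v∈X =
    [ [ middle-of-convex-P3⇒¬total-mutual-visibility u∈X
      , middle-of-convex-P3⇒¬total-mutual-visibility v∈X ]
    , middle-edge-of-convex-diamond⇒¬total-mutual-visibility u∈X v∈X ]

  convex-P3? : ∀ x y z → Dec (IsConvexP3 G x y z)
  convex-P3? x y z = E-dec x y ×-dec E-dec y z ×-dec ¬? (x ≟ z) ×-dec ¬? (E-dec x z)
    ×-dec all? (λ w → E-dec x w →-dec E-dec z w →-dec w ≟ y)

  convex-diamond? : ∀ v₁ v₂ v₃ v₄ → Dec (IsConvexDiamond G v₁ v₂ v₃ v₄)
  convex-diamond? v₁ v₂ v₃ v₄ = E-dec v₁ v₂ ×-dec E-dec v₂ v₃ ×-dec E-dec v₃ v₄ ×-dec E-dec v₄ v₁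
    ×-dec E-dec v₂ v₄ ×-dec ¬? (v₁ ≟ v₃) ×-dec ¬? (E-dec v₁ v₃)
    ×-dec all? (λ w → E-dec v₁ w →-dec E-dec v₃ w →-dec (w ≟ v₂ ⊎-dec w ≟ v₄))

  convex-obstruction? : ∀ u v → Dec (ConvexObstruction u v)
  convex-obstruction? u v = (middle? u ⊎-dec middle? v) ⊎-dec middle-edge?
    where
    middle? : ∀ y → Dec (IsMiddleOfConvexP3 G y)
    middle? y = any? λ x → any? λ z → convex-P3? x y z
    middle-edge? : Dec (IsMiddleEdgeOfConvexDiamond G u v)
    middle-edge? = any? λ v₁ → any? λ v₂ → any? λ v₃ → any? λ v₄ → convex-diamond? v₁ v₂ v₃ v₄
      ×-dec ((v₂ ≟ u ×-dec v₄ ≟ v) ⊎-dec (v₂ ≟ v ×-dec v₄ ≟ u))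

  only-common-neighbour : ∀ {p q c c'} → (∀ w → E p w → E q w → w ≡ c ⊎ w ≡ c') →
                          ¬ (E p c' × E c' q) → ∀ w → E p w → E q w → w ≡ c
  only-common-neighbour within ¬c' w pw qw with within w pw qw
  ... | inj₁ w≡c  = w≡c
  ... | inj₂ refl = ⊥-elim (¬c' (pw , E-sym qw))

  common-neighbours-in-edge⇒convex-obstruction :
    ∀ {u v p q} → E u v → AtDistanceTwo p q → (∀ w → E p w → E q w → w ≡ u ⊎ w ≡ v) →
    ConvexObstruction u v
  common-neighbours-in-edge⇒convex-obstruction {u} {v} {p} {q} uv (p≢q , ¬pq , a , pa , aq) within
    with E-dec p u ×-dec E-dec u q | E-dec p v ×-dec E-dec v q
  ... | yes (pu , uq) | yes (pv , vq) =
    inj₂ (p , u , q , v , (pu , uq , E-sym vq , E-sym pv , uv , p≢q , ¬pq , within)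
         , inj₁ (refl , refl))
  ... | yes (pu , uq) | no ¬v =
    inj₁ (inj₁ (p , q , pu , uq , p≢q , ¬pq , only-common-neighbour within ¬v))
  ... | no ¬u | yes (pv , vq) =
    inj₁ (inj₂ (p , q , pv , vq , p≢q , ¬pq ,
                only-common-neighbour (λ w pw qw → swap (within w pw qw)) ¬u))
  ... | no ¬u | no ¬v with within a pa (E-sym aq)
  ...   | inj₁ refl = ⊥-elim (¬u (pa , aq))
  ...   | inj₂ refl = ⊥-elim (¬v (pa , aq))

  ¬convex-obstruction⇒common-neighbour-outside :
    ∀ {u v} → E u v → ¬ ConvexObstruction u v → CommonNeighbourOutside (⁅ u ⁆ ∪ ⁅ v ⁆)
  ¬convex-obstruction⇒common-neighbour-outside {u} {v} uv ¬obstruction {p} {q} d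
    with any? (λ w → E-dec p w ×-dec E-dec w q ×-dec ¬? (w ∈? ⁅ u ⁆ ∪ ⁅ v ⁆))
  ... | yes found = found
  ... | no none = ⊥-elim (¬obstruction (common-neighbours-in-edge⇒convex-obstruction uv d within))
    where
    within : ∀ w → E p w → E q w → w ≡ u ⊎ w ≡ v
    within w pw qw =
      ∈-pair (decidable-stable (w ∈? ⁅ u ⁆ ∪ ⁅ v ⁆) (λ w∉ → none (w , pw , E-sym qw , w∉)))

theorem4p2 : (G : Graph) → Connected G →
    ((∀ (X : Subset (Graph.n G)) → IsTotalMutualVisibility G X → Independent G X)
      ⇔ (∀ u v → Graph.E G u v →
           (IsMiddleOfConvexP3 G u ⊎ IsMiddleOfConvexP3 G v) ⊎ IsMiddleEdgeOfConvexDiamond G u v))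
theorem4p2 G connected = mk⇔ independent⇒obstruction obstruction⇒independent
  where
  open Graph G using (E)

  independent⇒obstruction : (∀ X → IsTotalMutualVisibility G X → Independent G X) →
                            ∀ u v → E u v → ConvexObstruction G u v
  independent⇒obstruction tmv⇒independent u v uv =
    decidable-stable (convex-obstruction? G u v) λ ¬obstruction →
      tmv⇒independent (⁅ u ⁆ ∪ ⁅ v ⁆)
        (common-neighbour-outside⇒total-mutual-visibility G connected
          (¬convex-obstruction⇒common-neighbour-outside G uv ¬obstruction))
        u v (x∈p∪q⁺ (inj₁ (x∈⁅x⁆ u))) (x∈p∪q⁺ (inj₂ (x∈⁅x⁆ v))) uv

  obstruction⇒independent : (∀ u v → E u v → ConvexObstruction G u v) →
                            ∀ X → IsTotalMutualVisibility G X → Independent G X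
  obstruction⇒independent obstruction X tmv u v u∈X v∈X uv =
    convex-obstruction⇒¬total-mutual-visibility G u∈X v∈X (obstruction u v uv) tmv
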